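{- For all integers $n,k\ge 0$, \[ \sum_{\ell=0}^n\genfrac{[}{]}{0pt}{}{n+1}{\ell+1}B_\ell^{(-k)}=n!\,S_k(n+1) \qquad\text{and}\qquad \sum_{\ell=0}^n\genfrac{[}{]}{0pt}{}{n+1}{\ell+1}\widehat{\mathcal{B}}_\ell^k(1)=n!\,(n+1)^{k+1}. \]
   Context: For $k\in\mathbb{Z}$ the poly-Bernoulli polynomials are defined by $\sum_{n\ge 0}B_n^{(k)}(x)\frac{t^n}{n!}=e^{ -xt}\frac{\mathrm{Li}_k(1-e^{ -t})}{1-e^{ -t}}$ with $\mathrm{Li}_k(z)=\sum_{j\ge1}z^j/j^k$, and $B_n^{(k)}:=B_n^{(k)}(0)$. $\genfrac{[}{]}{0pt}{}{m}{j}$ denotes the unsigned Stirling numbers of the first kind. $\widehat{\mathcal{B}}_n^k(m):=\frac{1}{m!}\sum_{j=0}^{m}\genfrac{[}{]}{0pt}{}{m}{j}B_n^{(-k-j)}(m)$; in particular $\widehat{\mathcal{B}}_n^k(1)=B_n^{(-k-1)}(1)$. $S_k(n):=\sum_{i=1}^n i^k$. -}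

module Defs where

open import Data.Nat as ℕ using (ℕ; zero; suc)
open import Data.Nat.Combinatorics using (_C_)
open import Data.Integer using (ℤ; +_; -_; _+_; _*_; _^_)

sumBelow : ℕ → (ℕ → ℤ) → ℤ
sumBelow zero    f = + 0
sumBelow (suc n) f = sumBelow n f + f n

stirling1 : ℕ → ℕ → ℕ
stirling1 zero    zero    = 1
stirling1 zero    (suc k) = 0
stirling1 (suc n) zero    = 0
stirling1 (suc n) (suc k) = n ℕ.* stirling1 n (suc k) ℕ.+ stirling1 n k

-- Exponential generating functions over ℤ: a sequence a represents Σ a n tⁿ/n!
EGF : Set
EGF = ℕ → ℤ

-- product of EGFs (binomial convolution)
_⊛_ : EGF → EGF → EGF
(a ⊛ b) n = sumBelow (suc n) (λ i → + (n C i) * (a i * b (n ℕ.∸ i)))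

egfOne : EGF
egfOne zero    = + 1
egfOne (suc n) = + 0

egfPow : EGF → ℕ → EGF
egfPow a zero    = egfOne
egfPow a (suc m) = a ⊛ egfPow a m

egfExp : ℤ → EGF
egfExp c n = c ^ n

oneMinusExpNeg : EGF
oneMinusExpNeg n = egfOne n + - egfExp (- + 1) n

-- Li_{-k}(1 - e^{-t}) / (1 - e^{-t}) = Σ_{j ≥ 1} j^k (1 - e^{-t})^{j-1}.
-- Since (1 - e^{-t})^{j-1} = O(t^{j-1}), only j ≤ n+1 contribute to the
-- coefficient of tⁿ/n!, so the sum is truncated there (exactly).
polyBernGenNeg : ℕ → EGF
polyBernGenNeg k n =
  sumBelow (suc n) (λ i → (+ (suc i)) ^ k * egfPow oneMinusExpNeg i n)

-- B_n^{(-k)}(x): coefficients of e^{-x t} · Li_{-k}(1-e^{-t})/(1-e^{-t})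
polyBernPolyNeg : ℕ → ℕ → ℤ → ℤ
polyBernPolyNeg k n x = (egfExp (- x) ⊛ polyBernGenNeg k) n

polyBernNeg : ℕ → ℕ → ℤ
polyBernNeg k n = polyBernPolyNeg k n (+ 0)

-- m! · \hat{B}_n^k(m) = Σ_{j=0}^{m} [m , j] B_n^{(-k-j)}(m)
factHatB : ℕ → ℕ → ℕ → ℤ
factHatB n k m =
  sumBelow (suc m) (λ j → + stirling1 m j * polyBernPolyNeg (k ℕ.+ j) n (+ m))

-- \hat{B}_n^k(1) = (1/1!) Σ_{j=0}^{1} [1 , j] B_n^{(-k-j)}(1)  (1! = 1)
hatB1 : ℕ → ℕ → ℤ
hatB1 n k = factHatB n k 1

powerSum : ℕ → ℕ → ℤ
powerSum k n = sumBelow n (λ i → (+ (suc i)) ^ k)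

-- Both identities follow from one computation with the exponential generating
-- function P = 1 - e^{-t}.  Writing Lₙ(f) = Σ_{l≤n} [n+1, l+1] f_l for the
-- "Stirling transform" of a sequence f, we show
--
--     Lₙ(Pⁱ) = n!  for i ≤ n,        Lₙ(Pⁱ) = 0  for i > n.          (★)
--
-- Then it proves
-- the differential equation (P^{i+1})' = (i+1)(Pⁱ - P^{i+1}) and that Pⁱ = O(tⁱ),
-- and uses them with the Stirling recurrence Lₙ₊₁(f) = (n+1)Lₙ(f) + Lₙ(f')
-- to establish (★) by induction on n.
-- Finally, B_l^{(-k)} is the l-th coefficient of Σ_{i≤n} (i+1)^k Pⁱ, so the first
-- identity is linearity plus (★); and B̂_l^k(1) = B_l^{(-k-1)}(1) is the l-th
-- coefficient of e^{-t} Σ_{i≤n} (i+1)^{k+1} Pⁱ = Σ_{i≤n} (i+1)^{k+1} (Pⁱ - P^{i+1}),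
-- on which the Stirling transform telescopes to n!(n+1)^{k+1}.
module Submission where

open import Defs
open import Data.Nat using (ℕ; suc; _!)
open import Data.Integer using (ℤ; +_; _*_; _^_)
open import Data.Product using (_×_)
open import Relation.Binary.PropositionalEquality using (_≡_)

open import Data.Nat as ℕ using (zero; _≤_; _<_; z≤n; s≤s; _∸_)
import Data.Nat.Properties as ℕP
open import Data.Integer using (_-_; -_; _+_)
import Data.Integer.Properties as ℤP
open import Data.Integer.Tactic.RingSolver using (solve-∀)
open import Data.Nat.Combinatorics using (_C_; nCk+nC[k+1]≡[n+1]C[k+1]; k>n⇒nCk≡0)
open import Relation.Binary.PropositionalEquality
  using (refl; sym; trans; cong; cong₂; module ≡-Reasoning)
open import Data.Product using (_,_)
open import Data.Sum using (_⊎_; inj₁; inj₂)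

sum-cong : ∀ n {f g : ℕ → ℤ} → (∀ i → i < n → f i ≡ g i) → sumBelow n f ≡ sumBelow n g
sum-cong zero    eq = refl
sum-cong (suc n) eq =
  cong₂ _+_ (sum-cong n (λ i i<n → eq i (ℕP.m<n⇒m<1+n i<n))) (eq n (ℕP.n<1+n n))

sum-zero : ∀ n (f : ℕ → ℤ) → (∀ i → i < n → f i ≡ + 0) → sumBelow n f ≡ + 0
sum-zero zero    f eq = refl
sum-zero (suc n) f eq =
  cong₂ _+_ (sum-zero n f (λ i i<n → eq i (ℕP.m<n⇒m<1+n i<n))) (eq n (ℕP.n<1+n n))

sum-+ : ∀ n (f g : ℕ → ℤ) → sumBelow n (λ i → f i + g i) ≡ sumBelow n f + sumBelow n g
sum-+ zero    f g = refl
sum-+ (suc n) f g =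
  trans (cong (_+ (f n + g n)) (sum-+ n f g)) (shuffle (sumBelow n f) (sumBelow n g) (f n) (g n))
  where
  shuffle : ∀ a b c d → (a + b) + (c + d) ≡ (a + c) + (b + d)
  shuffle = solve-∀

sum-- : ∀ n (f g : ℕ → ℤ) → sumBelow n (λ i → f i - g i) ≡ sumBelow n f - sumBelow n g
sum-- zero    f g = refl
sum-- (suc n) f g =
  trans (cong (_+ (f n - g n)) (sum-- n f g)) (shuffle (sumBelow n f) (sumBelow n g) (f n) (g n))
  where
  shuffle : ∀ a b c d → (a - b) + (c - d) ≡ (a + c) - (b + d)
  shuffle = solve-∀

sum-scale : ∀ n c (f : ℕ → ℤ) → sumBelow n (λ i → c * f i) ≡ c * sumBelow n f
sum-scale zero    c f = sym (ℤP.*-zeroʳ c)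
sum-scale (suc n) c f =
  trans (cong (_+ (c * f n)) (sum-scale n c f)) (sym (ℤP.*-distribˡ-+ c (sumBelow n f) (f n)))

sum-swap : ∀ n m (f : ℕ → ℕ → ℤ) →
  sumBelow n (λ i → sumBelow m (f i)) ≡ sumBelow m (λ j → sumBelow n (λ i → f i j))
sum-swap zero    m f = sym (sum-zero m (λ _ → + 0) (λ _ _ → refl))
sum-swap (suc n) m f =
  trans (cong (_+ sumBelow m (f n)) (sum-swap n m f))
        (sym (sum-+ m (λ j → sumBelow n (λ i → f i j)) (f n)))

sum-first : ∀ n (f : ℕ → ℤ) → sumBelow (suc n) f ≡ f 0 + sumBelow n (λ i → f (suc i))
sum-first zero    f = trans (ℤP.+-identityˡ (f 0)) (sym (ℤP.+-identityʳ (f 0)))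
sum-first (suc n) f =
  trans (cong (_+ f (suc n)) (sum-first n f)) (ℤP.+-assoc (f 0) (sumBelow n (λ i → f (suc i))) (f (suc n)))

sum-truncate : ∀ M m (f : ℕ → ℤ) → m ≤ M → (∀ i → m ≤ i → f i ≡ + 0) →
  sumBelow M f ≡ sumBelow m f
sum-truncate M m f m≤M vanish =
  trans (cong (λ N → sumBelow N f) (sym (ℕP.m∸n+n≡m m≤M))) (drop (M ∸ m))
  where
  drop : ∀ d → sumBelow (d ℕ.+ m) f ≡ sumBelow m f
  drop zero    = refl
  drop (suc d) =
    trans (cong₂ _+_ (drop d) (vanish (d ℕ.+ m) (ℕP.m≤n+m m d))) (ℤP.+-identityʳ (sumBelow m f))

deriv : EGF → EGF
deriv a n = a (suc n)

⊛-congʳ : ∀ (a b b′ : EGF) l → (∀ m → m ≤ l → b m ≡ b′ m) → (a ⊛ b) l ≡ (a ⊛ b′) l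
⊛-congʳ a b b′ l eq =
  sum-cong (suc l) (λ i _ → cong (λ x → + (l C i) * (a i * x)) (eq (l ∸ i) (ℕP.m∸n≤m l i)))

⊛-congˡ : ∀ (a a′ b : EGF) l → (∀ j → a j ≡ a′ j) → (a ⊛ b) l ≡ (a′ ⊛ b) l
⊛-congˡ a a′ b l eq = sum-cong (suc l) (λ i _ → cong (λ x → + (l C i) * (x * b (l ∸ i))) (eq i))

⊛-identityˡ : ∀ (b : EGF) l → (egfOne ⊛ b) l ≡ b l
⊛-identityˡ b l = begin
  (egfOne ⊛ b) l
    ≡⟨ sum-first l (λ i → + (l C i) * (egfOne i * b (l ∸ i))) ⟩
  + 1 * (+ 1 * b l) + sumBelow l (λ i → + (l C suc i) * (+ 0 * b (l ∸ suc i)))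
    ≡⟨ cong₂ _+_ (trans (ℤP.*-identityˡ _) (ℤP.*-identityˡ (b l)))
                 (sum-zero l _ (λ i _ → ℤP.*-zeroʳ (+ (l C suc i)))) ⟩
  b l + + 0
    ≡⟨ ℤP.+-identityʳ (b l) ⟩
  b l ∎
  where open ≡-Reasoning

⊛-zeroʳ : ∀ (a : EGF) l → (a ⊛ (λ _ → + 0)) l ≡ + 0
⊛-zeroʳ a l = sum-zero (suc l) _
  (λ i _ → trans (cong (+ (l C i) *_) (ℤP.*-zeroʳ (a i))) (ℤP.*-zeroʳ (+ (l C i))))

⊛-distribʳ-- : ∀ (a a′ b : EGF) l → ((λ j → a j - a′ j) ⊛ b) l ≡ (a ⊛ b) l - (a′ ⊛ b) l
⊛-distribʳ-- a a′ b l =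
  trans (sum-cong (suc l) (λ i _ → distrib (+ (l C i)) (a i) (a′ i) (b (l ∸ i)))) (sum-- (suc l) _ _)
  where
  distrib : ∀ e x y z → e * ((x - y) * z) ≡ e * (x * z) - e * (y * z)
  distrib = solve-∀

⊛-linearʳ : ∀ (a : EGF) M (c : ℕ → ℤ) (f : ℕ → EGF) l →
  (a ⊛ (λ m → sumBelow M (λ i → c i * f i m))) l ≡ sumBelow M (λ i → c i * (a ⊛ f i) l)
⊛-linearʳ a M c f l =
  trans (sum-cong (suc l) (λ j _ → pullIn j))
  (trans (sum-swap (suc l) M (λ j i → c i * (+ (l C j) * (a j * f i (l ∸ j)))))
         (sum-cong M (λ i _ → sum-scale (suc l) (c i) (λ j → + (l C j) * (a j * f i (l ∸ j))))))
  where
  assoc : ∀ e x s → e * (x * s) ≡ (e * x) * s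
  assoc = solve-∀
  commute : ∀ e x c y → (e * x) * (c * y) ≡ c * (e * (x * y))
  commute = solve-∀
  pullIn : ∀ j → + (l C j) * (a j * sumBelow M (λ i → c i * f i (l ∸ j)))
               ≡ sumBelow M (λ i → c i * (+ (l C j) * (a j * f i (l ∸ j))))
  pullIn j = trans (assoc (+ (l C j)) (a j) (sumBelow M (λ i → c i * f i (l ∸ j))))
    (trans (sym (sum-scale M (+ (l C j) * a j) (λ i → c i * f i (l ∸ j))))
           (sum-cong M (λ i _ → commute (+ (l C j)) (a j) (c i) (f i (l ∸ j)))))

⊛-linearʳ-diff : ∀ (a b b′ : EGF) c l →
  (a ⊛ (λ m → c * (b m - b′ m))) l ≡ c * ((a ⊛ b) l - (a ⊛ b′) l)
⊛-linearʳ-diff a b b′ c l =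
  trans (sum-cong (suc l) (λ i _ → distrib (+ (l C i)) (a i) c (b (l ∸ i)) (b′ (l ∸ i))))
  (trans (sum-- (suc l) _ _)
  (trans (cong₂ _-_ (sum-scale (suc l) c _) (sum-scale (suc l) c _))
         (factor c _ _)))
  where
  distrib : ∀ e x c y z → e * (x * (c * (y - z))) ≡ c * (e * (x * y)) - c * (e * (x * z))
  distrib = solve-∀
  factor : ∀ c A B → c * A - c * B ≡ c * (A - B)
  factor = solve-∀

-- Leibniz rule (ab)' = a'b + ab', from Pascal's rule for the binomial weights.
leibniz : ∀ (a b : EGF) n → deriv (a ⊛ b) n ≡ (deriv a ⊛ b) n + (a ⊛ deriv b) n
leibniz a b n = begin
    (a ⊛ b) (suc n)
  ≡⟨ sum-first (suc n) _ ⟩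
    first + sumBelow (suc n) (λ i → + (suc n C suc i) * (a (suc i) * b (n ∸ i)))
  ≡⟨ cong (λ z → first + z) (trans (sum-cong (suc n) (λ i _ → pascal i)) (sum-+ (suc n) X Y)) ⟩
    first + (sumBelow (suc n) X + (sumBelow n Y + Y n))
  ≡⟨ cong (λ z → first + (sumBelow (suc n) X + (sumBelow n Y + z))) lastY≡0 ⟩
    first + (sumBelow (suc n) X + (sumBelow n Y + + 0))
  ≡⟨ cong (λ z → first + (sumBelow (suc n) X + (z + + 0))) (sum-cong n Y≡Y′) ⟩
    first + (sumBelow (suc n) X + (sumBelow n Y′ + + 0))
  ≡⟨ regroup first (sumBelow (suc n) X) (sumBelow n Y′) ⟩
    sumBelow (suc n) X + (first + sumBelow n Y′)
  ≡⟨ cong (λ z → sumBelow (suc n) X + z) (sym (sum-first n _)) ⟩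
    (deriv a ⊛ b) n + (a ⊛ deriv b) n
  ∎
  where
  open ≡-Reasoning
  first = + 1 * (a 0 * b (suc n))
  X Y Y′ : ℕ → ℤ
  X i = + (n C i) * (a (suc i) * b (n ∸ i))
  Y i = + (n C suc i) * (a (suc i) * b (n ∸ i))
  Y′ i = + (n C suc i) * (a (suc i) * b (suc (n ∸ suc i)))
  pascal : ∀ i → + (suc n C suc i) * (a (suc i) * b (n ∸ i)) ≡ X i + Y i
  pascal i = trans
    (cong (_* (a (suc i) * b (n ∸ i)))
          (trans (cong +_ (sym (nCk+nC[k+1]≡[n+1]C[k+1] n i))) (ℤP.pos-+ (n C i) (n C suc i))))
    (ℤP.*-distribʳ-+ (a (suc i) * b (n ∸ i)) (+ (n C i)) (+ (n C suc i)))
  lastY≡0 : Y n ≡ + 0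
  lastY≡0 = cong (λ z → + z * (a (suc n) * b (n ∸ n))) (k>n⇒nCk≡0 (ℕP.n<1+n n))
  Y≡Y′ : ∀ i → i < n → Y i ≡ Y′ i
  Y≡Y′ i i<n = cong (λ m → + (n C suc i) * (a (suc i) * b m)) (ℕP.+-∸-assoc 1 i<n)
  regroup : ∀ p x y → p + (x + (y + + 0)) ≡ x + (p + y)
  regroup = solve-∀

P : EGF
P = oneMinusExpNeg

Pow : ℕ → EGF
Pow i = egfPow P i

expNeg≡1-P : ∀ j → egfExp (- + 1) j ≡ egfOne j - P j
expNeg≡1-P j = identity (egfOne j) (egfExp (- + 1) j)
  where
  identity : ∀ o x → x ≡ o - (o + - x)
  identity = solve-∀

deriv-P : ∀ j → deriv P j ≡ egfExp (- + 1) j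
deriv-P j = identity (egfExp (- + 1) j)
  where
  identity : ∀ x → + 0 + - ((- + 1) * x) ≡ x
  identity = solve-∀

expNeg⊛Pow : ∀ i l → (egfExp (- + 1) ⊛ Pow i) l ≡ Pow i l - Pow (suc i) l
expNeg⊛Pow i l =
  trans (⊛-congˡ _ _ (Pow i) l expNeg≡1-P)
  (trans (⊛-distribʳ-- egfOne P (Pow i) l) (cong (_- Pow (suc i) l) (⊛-identityˡ (Pow i) l)))

-- The differential equation (P^{i+1})′ = (i+1)(Pⁱ - P^{i+1}), proved together
-- with its consequence P·(Pⁱ)′ = i(Pⁱ - P^{i+1}) that feeds the Leibniz rule.
deriv-Pow : ∀ i l → deriv (Pow (suc i)) l ≡ + (suc i) * (Pow i l - Pow (suc i) l)
P⊛deriv-Pow : ∀ i l → (P ⊛ deriv (Pow i)) l ≡ + i * (Pow i l - Pow (suc i) l)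

deriv-Pow i l =
  trans (leibniz P (Pow i) l)
  (trans (cong₂ _+_ (trans (⊛-congˡ _ _ (Pow i) l deriv-P) (expNeg⊛Pow i l)) (P⊛deriv-Pow i l))
         (collect (Pow i l - Pow (suc i) l) i))
  where
  collect : ∀ A i → A + + i * A ≡ + (suc i) * A
  collect A i = trans (cong (_+ + i * A) (sym (ℤP.*-identityˡ A))) (sym (ℤP.*-distribʳ-+ A (+ 1) (+ i)))

P⊛deriv-Pow zero l =
  trans (⊛-zeroʳ P l) (sym (ℤP.*-zeroˡ (Pow 0 l - Pow 1 l)))
P⊛deriv-Pow (suc i) l =
  trans (⊛-congʳ P _ _ l (λ m _ → deriv-Pow i m)) (⊛-linearʳ-diff P (Pow i) (Pow (suc i)) (+ suc i) l)

Pow-vanish : ∀ l i → l < i → Pow i l ≡ + 0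
Pow-vanish zero    (suc i) _         = refl
Pow-vanish (suc l) (suc i) (s≤s l<i) =
  trans (deriv-Pow i l)
  (trans (cong₂ (λ x y → + suc i * (x - y)) (Pow-vanish l i l<i) (Pow-vanish l (suc i) (ℕP.m<n⇒m<1+n l<i)))
         (ℤP.*-zeroʳ (+ suc i)))

polyBernGen-expand : ∀ k M l → l < M →
  polyBernGenNeg k l ≡ sumBelow M (λ i → (+ (suc i)) ^ k * Pow i l)
polyBernGen-expand k M l l<M = sym (sum-truncate M (suc l) _ l<M
  (λ i l<i → trans (cong ((+ (suc i)) ^ k *_) (Pow-vanish l i l<i)) (ℤP.*-zeroʳ ((+ (suc i)) ^ k))))

stirling1-vanish : ∀ n j → n < j → stirling1 n j ≡ 0
stirling1-vanish zero    (suc j) _ = refl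
stirling1-vanish (suc n) (suc j) (s≤s n<j)
  rewrite stirling1-vanish n (suc j) (ℕP.m<n⇒m<1+n n<j) | stirling1-vanish n j n<j =
  trans (ℕP.+-identityʳ _) (ℕP.*-zeroʳ n)

weight : ℕ → ℕ → ℤ
weight n l = + stirling1 (suc n) (suc l)

stirlingTransform : ℕ → EGF → ℤ
stirlingTransform n f = sumBelow (suc n) (λ l → weight n l * f l)

transform-cong : ∀ n (f g : EGF) → (∀ l → l ≤ n → f l ≡ g l) →
  stirlingTransform n f ≡ stirlingTransform n g
transform-cong n f g eq =
  sum-cong (suc n) (λ l l<1+n → cong (weight n l *_) (eq l (ℕP.≤-pred l<1+n)))

transform-- : ∀ n (f g : EGF) →
  stirlingTransform n (λ l → f l - g l) ≡ stirlingTransform n f - stirlingTransform n g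
transform-- n f g =
  trans (sum-cong (suc n) (λ l _ → distrib (weight n l) (f l) (g l)))
        (sum-- (suc n) (λ l → weight n l * f l) (λ l → weight n l * g l))
  where
  distrib : ∀ s x y → s * (x - y) ≡ s * x - s * y
  distrib = solve-∀

transform-scale : ∀ n c (f : EGF) → stirlingTransform n (λ l → c * f l) ≡ c * stirlingTransform n f
transform-scale n c f =
  trans (sum-cong (suc n) (λ l _ → swap (weight n l) c (f l))) (sum-scale (suc n) c (λ l → weight n l * f l))
  where
  swap : ∀ s c x → s * (c * x) ≡ c * (s * x)
  swap = solve-∀

transform-linear : ∀ n M (c : ℕ → ℤ) (f : ℕ → EGF) →
  stirlingTransform n (λ l → sumBelow M (λ i → c i * f i l))
    ≡ sumBelow M (λ i → c i * stirlingTransform n (f i))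
transform-linear n M c f =
  trans (sum-cong (suc n) (λ l _ → trans (sym (sum-scale M (weight n l) (λ i → c i * f i l)))
                                         (sum-cong M (λ i _ → swap (weight n l) (c i) (f i l)))))
  (trans (sum-swap (suc n) M (λ l i → c i * (weight n l * f i l)))
         (sum-cong M (λ i _ → sum-scale (suc n) (c i) (λ l → weight n l * f i l))))
  where
  swap : ∀ s c x → s * (c * x) ≡ c * (s * x)
  swap = solve-∀

transform-recurrence : ∀ n (f : EGF) →
  stirlingTransform (suc n) f ≡ + (suc n) * stirlingTransform n f + stirlingTransform n (deriv f)
transform-recurrence n f =
  trans (sum-cong (suc (suc n)) (λ l _ → split l))
  (trans (sum-+ (suc (suc n)) (λ l → + suc n * g l) (λ l → + stirling1 (suc n) l * f l))
  (cong₂ _+_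
    (trans (sum-scale (suc (suc n)) (+ suc n) g) (cong (+ suc n *_) dropLast))
    (trans (sum-first (suc n) (λ l → + stirling1 (suc n) l * f l))
           (ℤP.+-identityˡ (stirlingTransform n (deriv f))))))
  where
  g : ℕ → ℤ
  g l = weight n l * f l
  dropLast : sumBelow (suc (suc n)) g ≡ stirlingTransform n f
  dropLast =
    trans (cong (λ z → sumBelow (suc n) g + + z * f (suc n))
                (stirling1-vanish (suc n) (suc (suc n)) (ℕP.n<1+n (suc n))))
          (ℤP.+-identityʳ (stirlingTransform n f))
  distrib : ∀ c s t x → (c * s + t) * x ≡ c * (s * x) + t * x
  distrib = solve-∀
  split : ∀ l → + stirling1 (suc (suc n)) (suc l) * f l ≡ + suc n * g l + + stirling1 (suc n) l * f l
  split l = trans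
    (cong (_* f l) (trans (ℤP.pos-+ (suc n ℕ.* stirling1 (suc n) (suc l)) (stirling1 (suc n) l))
                          (cong (_+ + stirling1 (suc n) l) (ℤP.pos-* (suc n) (stirling1 (suc n) (suc l))))))
    (distrib (+ suc n) (+ stirling1 (suc n) (suc l)) (+ stirling1 (suc n) l) (f l))

transform-Pow-large : ∀ n i → n < i → stirlingTransform n (Pow i) ≡ + 0
transform-Pow-large n i n<i = sum-zero (suc n) _ (λ l l<1+n →
  trans (cong (weight n l *_) (Pow-vanish l i (ℕP.≤-trans l<1+n n<i))) (ℤP.*-zeroʳ (weight n l)))

-- It is proved together with the differences Lₙ(Pⁱ) - Lₙ(P^{i+1}) (0 for i < n,
-- n! for i = n), which drive its inductive step and the telescoping sum below.
transform-Pow : ∀ n i → i ≤ n → stirlingTransform n (Pow i) ≡ + (n !)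
transform-Pow-diff-below : ∀ n i → i < n →
  stirlingTransform n (Pow i) - stirlingTransform n (Pow (suc i)) ≡ + 0
transform-Pow-diff-top : ∀ n →
  stirlingTransform n (Pow n) - stirlingTransform n (Pow (suc n)) ≡ + (n !)

transform-Pow zero    zero    z≤n = refl
transform-Pow (suc n) zero    _   = begin
  stirlingTransform (suc n) (Pow 0)
    ≡⟨ transform-recurrence n (Pow 0) ⟩
  + suc n * stirlingTransform n (Pow 0) + stirlingTransform n (deriv (Pow 0))
    ≡⟨ cong₂ _+_ (cong (+ suc n *_) (transform-Pow n zero z≤n))
                 (sum-zero (suc n) _ (λ l _ → ℤP.*-zeroʳ (weight n l))) ⟩
  + suc n * + (n !) + + 0
    ≡⟨ trans (ℤP.+-identityʳ _) (sym (ℤP.pos-* (suc n) (n !))) ⟩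
  + (suc n !) ∎
  where open ≡-Reasoning
transform-Pow (suc n) (suc i) (s≤s i≤n) = begin
  stirlingTransform (suc n) (Pow (suc i))
    ≡⟨ transform-recurrence n (Pow (suc i)) ⟩
  + suc n * stirlingTransform n (Pow (suc i)) + stirlingTransform n (deriv (Pow (suc i)))
    ≡⟨ cong (λ z → + suc n * stirlingTransform n (Pow (suc i)) + z)
            (trans (transform-cong n _ _ (λ l _ → deriv-Pow i l))
            (trans (transform-scale n (+ suc i) _) (cong (+ suc i *_) (transform-- n (Pow i) (Pow (suc i)))))) ⟩
  + suc n * stirlingTransform n (Pow (suc i))
    + + suc i * (stirlingTransform n (Pow i) - stirlingTransform n (Pow (suc i)))
    ≡⟨ byCase (ℕP.m≤n⇒m<n∨m≡n i≤n) ⟩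
  + suc n * + (n !)
    ≡⟨ sym (ℤP.pos-* (suc n) (n !)) ⟩
  + (suc n !) ∎
  where
  open ≡-Reasoning
  byCase : i < n ⊎ i ≡ n →
    + suc n * stirlingTransform n (Pow (suc i))
      + + suc i * (stirlingTransform n (Pow i) - stirlingTransform n (Pow (suc i)))
    ≡ + suc n * + (n !)
  byCase (inj₁ i<n) = begin
    + suc n * stirlingTransform n (Pow (suc i))
      + + suc i * (stirlingTransform n (Pow i) - stirlingTransform n (Pow (suc i)))
      ≡⟨ cong₂ (λ x y → + suc n * x + + suc i * y) (transform-Pow n (suc i) i<n)
                                                  (transform-Pow-diff-below n i i<n) ⟩
    + suc n * + (n !) + + suc i * + 0
      ≡⟨ trans (cong (λ z → + suc n * + (n !) + z) (ℤP.*-zeroʳ (+ suc i))) (ℤP.+-identityʳ _) ⟩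
    + suc n * + (n !) ∎
  byCase (inj₂ refl) = begin
    + suc n * stirlingTransform n (Pow (suc n))
      + + suc n * (stirlingTransform n (Pow n) - stirlingTransform n (Pow (suc n)))
      ≡⟨ cong₂ (λ x y → + suc n * x + + suc n * y) (transform-Pow-large n (suc n) (ℕP.n<1+n n))
                                                  (transform-Pow-diff-top n) ⟩
    + suc n * + 0 + + suc n * + (n !)
      ≡⟨ trans (cong (_+ + suc n * + (n !)) (ℤP.*-zeroʳ (+ suc n))) (ℤP.+-identityˡ _) ⟩
    + suc n * + (n !) ∎

transform-Pow-diff-below n i i<n
  rewrite transform-Pow n i (ℕP.<⇒≤ i<n) | transform-Pow n (suc i) i<n = ℤP.+-inverseʳ (+ (n !))
transform-Pow-diff-top n
  rewrite transform-Pow n n ℕP.≤-refl | transform-Pow-large n (suc n) (ℕP.n<1+n n) =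
  ℤP.+-identityʳ (+ (n !))

polyBernNeg≡gen : ∀ k l → polyBernNeg k l ≡ polyBernGenNeg k l
polyBernNeg≡gen k l =
  trans (⊛-congˡ (egfExp (- + 0)) egfOne (polyBernGenNeg k) l exp0≡1) (⊛-identityˡ (polyBernGenNeg k) l)
  where
  exp0≡1 : ∀ j → egfExp (- + 0) j ≡ egfOne j
  exp0≡1 zero    = refl
  exp0≡1 (suc j) = refl

-- B̂_l^k(1) = [1,0] B_l^{(-k)}(1) + [1,1] B_l^{(-k-1)}(1) = B_l^{(-k-1)}(1).
hatB1≡polyBernPoly : ∀ l k → hatB1 l k ≡ polyBernPolyNeg (suc k) l (+ 1)
hatB1≡polyBernPoly l k =
  trans (simplify (polyBernPolyNeg (k ℕ.+ 0) l (+ 1)) (polyBernPolyNeg (k ℕ.+ 1) l (+ 1)))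
        (cong (λ K → polyBernPolyNeg K l (+ 1)) (ℕP.+-comm k 1))
  where
  simplify : ∀ X Y → (+ 0 + + 0 * X) + + 1 * Y ≡ Y
  simplify = solve-∀

-- Σ_{l≤n} [n+1,l+1] B_l^{(-k)} = Lₙ(Σ_{i≤n} (i+1)^k Pⁱ) = n! S_k(n+1).
stirling-polyBern : ∀ n k →
  sumBelow (suc n) (λ l → + stirling1 (suc n) (suc l) * polyBernNeg k l) ≡ + (n !) * powerSum k (suc n)
stirling-polyBern n k =
  trans (transform-cong n _ (λ l → sumBelow (suc n) (λ i → c i * Pow i l))
          (λ l l≤n → trans (polyBernNeg≡gen k l) (polyBernGen-expand k (suc n) l (s≤s l≤n))))
  (trans (transform-linear n (suc n) c Pow)
  (trans (sum-cong (suc n) (λ i i<1+n → trans (cong (c i *_) (transform-Pow n i (ℕP.≤-pred i<1+n)))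
                                             (ℤP.*-comm (c i) (+ (n !)))))
         (sum-scale (suc n) (+ (n !)) c)))
  where
  c : ℕ → ℤ
  c i = (+ (suc i)) ^ k

-- Σ_{l≤n} [n+1,l+1] B̂_l^k(1) = Lₙ(Σ_{i≤n} (i+1)^{k+1} (Pⁱ - P^{i+1})) = n!(n+1)^{k+1}:
-- only the term i = n survives.
stirling-hatB1 : ∀ n k →
  sumBelow (suc n) (λ l → + stirling1 (suc n) (suc l) * hatB1 l k) ≡ + (n !) * (+ (suc n)) ^ (suc k)
stirling-hatB1 n k =
  trans (transform-cong n _ (λ l → sumBelow (suc n) (λ i → c i * (Pow i l - Pow (suc i) l))) coefficient)
  (trans (transform-linear n (suc n) c (λ i l → Pow i l - Pow (suc i) l))
  (trans (sum-cong (suc n) (λ i _ → cong (c i *_) (transform-- n (Pow i) (Pow (suc i)))))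
  (trans (cong₂ _+_
           (sum-zero n _ (λ i i<n → trans (cong (c i *_) (transform-Pow-diff-below n i i<n)) (ℤP.*-zeroʳ (c i))))
           (cong (c n *_) (transform-Pow-diff-top n)))
         (trans (ℤP.+-identityˡ _) (ℤP.*-comm (c n) (+ (n !)))))))
  where
  c : ℕ → ℤ
  c i = (+ (suc i)) ^ suc k
  coefficient : ∀ l → l ≤ n → hatB1 l k ≡ sumBelow (suc n) (λ i → c i * (Pow i l - Pow (suc i) l))
  coefficient l l≤n =
    trans (hatB1≡polyBernPoly l k)
    (trans (⊛-congʳ (egfExp (- + 1)) (polyBernGenNeg (suc k)) _ l
              (λ m m≤l → polyBernGen-expand (suc k) (suc n) m (s≤s (ℕP.≤-trans m≤l l≤n))))
    (trans (⊛-linearʳ (egfExp (- + 1)) (suc n) c Pow l)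
           (sum-cong (suc n) (λ i _ → cong (c i *_) (expNeg⊛Pow i l)))))

mainTheorem14 : (n k : ℕ) →
    (sumBelow (suc n) (λ l → + stirling1 (suc n) (suc l) * polyBernNeg k l)
    ≡ + (n !) * powerSum k (suc n))
    × (sumBelow (suc n) (λ l → + stirling1 (suc n) (suc l) * hatB1 l k)
    ≡ + (n !) * (+ (suc n)) ^ (suc k))
mainTheorem14 n k = stirling-polyBern n k , stirling-hatB1 n k
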